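{- For each positive integer $k$ there exists a constant $c=c(k)$ such that for every integer $r\geq c(k)$ and all sufficiently large $n$, $$ex_\phi(n,K_{r+1})=e_\phi(T_r(n)),$$ where $c(k)=1+\lim_{n\to\infty}(n/c_1)$, and $c_1$, with $0\leq c_1\leq n-k$, is the root of the function $x\mapsto 1-x\Psi(n-x+1)+x\Psi(n-x-k+1)$, $\Psi$ denoting the Digamma function.
   Context: All graphs are finite, simple and undirected. For a positive integer $k$ and a graph $G$ with degree sequence $d_1,\ldots,d_n$, define $e_\phi(G)=\sum_{i=1}^n\binom{d_i}{k}$. For a graph $H$, $ex_\phi(n,H)$ denotes the maximum of $e_\phi(G)$ over all graphs $G$ on $n$ vertices that do not contain $H$ as a subgraph. $K_{r+1}$ is the complete graph on $r+1$ vertices, and $T_r(n)$ is the complete $r$-partite graph on $n$ vertices whose part sizes differ by at most one. The Digamma function is $\Psi(x)=\Gamma'(x)/\Gamma(x)$. Throughout, $k\leq n/2$ is assumed. -}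

module Defs where

open import Data.Nat using (ℕ; zero; suc; _+_; _≤_; _%_)
open import Data.Nat.Combinatorics using (_C_)
open import Data.Bool using (Bool; true; false; if_then_else_)
open import Data.Fin using (Fin; toℕ)
open import Data.List using (List; map; allFin)
open import Data.Nat.ListAction using (sum)
open import Data.Product using (Σ; _×_)
open import Relation.Binary.PropositionalEquality using (_≡_; _≢_)
open import Relation.Nullary using (¬_; yes; no)
open import Data.Empty using (⊥-elim)
import Relation.Binary.PropositionalEquality as P
open P using (refl)
open import Data.Nat using (_≟_)
open import Relation.Nullary.Decidable using (⌊_⌋)
open import Data.Bool using (not)
open import Function.Definitions using (Injective)

record Graph (n : ℕ) : Set where
  field
    adj   : Fin n → Fin n → Bool
    sym   : ∀ u v → adj u v ≡ adj v u
    irrefl : ∀ v → adj v v ≡ false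
open Graph public

degree : ∀ {n} → Graph n → Fin n → ℕ
degree {n} G v = sum (map (λ u → if adj G v u then 1 else 0) (allFin n))

eφ : ℕ → ∀ {n} → Graph n → ℕ
eφ k {n} G = sum (map (λ v → degree G v C k) (allFin n))

ContainsK : ℕ → ∀ {n} → Graph n → Set
ContainsK m {n} G =
  Σ (Fin m → Fin n) λ f → Injective _≡_ _≡_ f × (∀ i j → i ≢ j → adj G (f i) (f j) ≡ true)

IsExφ : ℕ → ℕ → ℕ → ℕ → Set
IsExφ k n m e =
  Σ (Graph n) (λ G → ¬ ContainsK m G × eφ k G ≡ e)
  × (∀ (G : Graph n) → ¬ ContainsK m G → eφ k G ≤ e)

part : ∀ {n} → ℕ → Fin n → ℕ
part zero    i = 0
part (suc r) i = toℕ i % suc r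

turanAdj : ∀ {n} → ℕ → Fin n → Fin n → Bool
turanAdj r i j = not ⌊ part r i ≟ part r j ⌋

-- Turán graph T_r(n): complete r-partite, parts = residue classes mod r
-- (sizes differ by at most one). Meaningful for r ≥ 1.
private
  ≟-sym : (a b : ℕ) → ⌊ a ≟ b ⌋ ≡ ⌊ b ≟ a ⌋
  ≟-sym a b with a ≟ b | b ≟ a
  ... | yes _ | yes _ = refl
  ... | no _  | no _  = refl
  ... | yes p | no q  = ⊥-elim (q (P.sym p))
  ... | no p  | yes q = ⊥-elim (p (P.sym q))

  ≟-refl : (a : ℕ) → ⌊ a ≟ a ⌋ ≡ true
  ≟-refl a with a ≟ a
  ... | yes _ = refl
  ... | no p  = ⊥-elim (p refl)

turán : (n r : ℕ) → Graph n
turán n r = record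
  { adj    = turanAdj r
  ; sym    = λ u v → P.cong not (≟-sym (part r u) (part r v))
  ; irrefl = λ v → P.cong not (≟-refl (part r v))
  }

module Submission where

-- By Erdős's degree-majorisation theorem, a K_{r+1}-free graph G has on its vertex set a complete
-- r-partite graph H with deg_G v ≤ deg_H v for every v, so eφ(G) ≤ eφ(H). If the parts of H have
-- sizes a_1, …, a_r then eφ(H) = Σ w(a_i) with w(a) = a·C(n − a, k). The function w is concave
-- while (k+1)(a+1) + k ≤ 2n + 1 and decreasing once n + 1 ≤ (k+1)(a+1); for r ≥ k + 2 and n ≥ kr
-- the balanced size q = ⌊n/r⌋ lies where w rises and is concave, so w lies below its chord
-- through q and q + 1, and Σ w(a_i) is largest for the part sizes q and q + 1 of T_r(n).

open import Data.Bool using (Bool; true; false; if_then_else_; not; _∧_)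
open import Data.Bool.Properties using (∧-conicalˡ; ∧-conicalʳ)
open import Data.Empty using (⊥; ⊥-elim)
open import Data.Fin using (Fin; zero; suc; toℕ; fromℕ<)
open import Data.Fin.Properties using (toℕ<n; pigeonhole; toℕ-fromℕ<)
import Data.Fin.Properties as Fin
open import Data.List using (map; allFin; tabulate)
open import Data.List.Properties using (map-tabulate)
open import Data.Nat
open import Data.Nat.Combinatorics using (_C_; nC1≡n; nCk+nC[k+1]≡[n+1]C[k+1])
open import Data.Nat.DivMod using (_/_; _%_; m%n<n; m<n⇒m%n≡m; m≡m%n+[m/n]*n; [m+kn]%n≡m%n; m/n*n≤m; m*n/n≡m; /-monoˡ-≤)
import Data.Nat.ListAction as L
open import Data.Nat.Properties
open import Data.Nat.Tactic.RingSolver using (solve-∀)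
open import Data.Product using (Σ; _×_; _,_; proj₁; proj₂)
open import Data.Sum using (_⊎_; inj₁; inj₂)
open import Function using (_∘_; id)
open import Function.Definitions using (Injective)
open import Relation.Binary.PropositionalEquality
open import Relation.Nullary using (¬_; yes; no)
open import Relation.Nullary.Decidable using (⌊_⌋)
open import Algebra.Properties.Semiring.Sum +-*-semiring using (sum; sum-cong-≗; ∑-distrib-+; ∑-comm; *-distribʳ-sum)
open import Defs hiding (sym)
import Defs

𝟙 : Bool → ℕ
𝟙 b = if b then 1 else 0

𝟙≤1 : ∀ b → 𝟙 b ≤ 1
𝟙≤1 true  = ≤-refl
𝟙≤1 false = z≤n

𝟙-not : ∀ b → 𝟙 (not b) + 𝟙 b ≡ 1
𝟙-not true  = refl
𝟙-not false = refl

true≢false : true ≢ false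
true≢false ()

⌊≟⌋-refl : ∀ a → ⌊ a ≟ a ⌋ ≡ true
⌊≟⌋-refl a = cong ⌊_⌋ (≟-diag {a} refl)

⌊≟⌋-≢ : ∀ {a b} → a ≢ b → ⌊ a ≟ b ⌋ ≡ false
⌊≟⌋-≢ a≢b = cong ⌊_⌋ (≢-≟-identity _≟_ a≢b)

⌊≟⌋-sym : ∀ a b → ⌊ a ≟ b ⌋ ≡ ⌊ b ≟ a ⌋
⌊≟⌋-sym a b with a ≟ b
... | yes refl = sym (⌊≟⌋-refl a)
... | no  a≢b  = sym (⌊≟⌋-≢ (≢-sym a≢b))

⌊≟⌋-suc : ∀ a b → ⌊ suc a ≟ suc b ⌋ ≡ ⌊ a ≟ b ⌋
⌊≟⌋-suc a b with a ≟ b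
... | yes refl = ⌊≟⌋-refl (suc a)
... | no  a≢b  = ⌊≟⌋-≢ (a≢b ∘ suc-injective)

∑-mono-≤ : ∀ {r} {f g : Fin r → ℕ} → (∀ i → f i ≤ g i) → sum f ≤ sum g
∑-mono-≤ {zero}  f≤g = z≤n
∑-mono-≤ {suc r} f≤g = +-mono-≤ (f≤g zero) (∑-mono-≤ (f≤g ∘ suc))

∑-const : ∀ r c → sum {r} (λ _ → c) ≡ r * c
∑-const zero    c = refl
∑-const (suc r) c = cong (c +_) (∑-const r c)

∑-*ʳ : ∀ {r} (f : Fin r → ℕ) c → sum (λ i → f i * c) ≡ sum f * c
∑-*ʳ f c = sym (*-distribʳ-sum c f)

∑-zero : ∀ {r} (f : Fin r → ℕ) → (∀ i → f i ≡ 0) → sum f ≡ 0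
∑-zero {r} f f≡0 = trans (sum-cong-≗ f≡0) (trans (∑-const r 0) (*-zeroʳ r))

∑-select : ∀ {r} (F : ℕ → ℕ) a → a < r → sum {r} (λ i → 𝟙 ⌊ toℕ i ≟ a ⌋ * F (toℕ i)) ≡ F a
∑-select {suc r} F zero    _ = begin
  𝟙 ⌊ 0 ≟ 0 ⌋ * F 0 + sum {r} (λ i → 𝟙 ⌊ suc (toℕ i) ≟ 0 ⌋ * F (suc (toℕ i)))
    ≡⟨ cong₂ (λ b s → 𝟙 b * F 0 + s) (⌊≟⌋-refl 0) (∑-zero {r} _ others-vanish) ⟩
  F 0 + 0 + 0
    ≡⟨ trans (+-identityʳ _) (+-identityʳ (F 0)) ⟩
  F 0 ∎
  where
    open ≡-Reasoning
    others-vanish : ∀ i → 𝟙 ⌊ suc (toℕ i) ≟ 0 ⌋ * F (suc (toℕ i)) ≡ 0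
    others-vanish i = cong (λ b → 𝟙 b * F (suc (toℕ i))) (⌊≟⌋-≢ {suc (toℕ i)} {0} λ ())
∑-select {suc r} F (suc a) (s≤s a<r) = begin
  𝟙 ⌊ 0 ≟ suc a ⌋ * F 0 + sum {r} (λ i → 𝟙 ⌊ suc (toℕ i) ≟ suc a ⌋ * F (suc (toℕ i)))
    ≡⟨ cong₂ (λ b s → 𝟙 b * F 0 + s) (⌊≟⌋-≢ {0} {suc a} λ ()) (sum-cong-≗ {r} shift-down) ⟩
  sum {r} (λ i → 𝟙 ⌊ toℕ i ≟ a ⌋ * F (suc (toℕ i)))
    ≡⟨ ∑-select (F ∘ suc) a a<r ⟩
  F (suc a) ∎
  where
    open ≡-Reasoning
    shift-down : ∀ i → 𝟙 ⌊ suc (toℕ i) ≟ suc a ⌋ * F (suc (toℕ i)) ≡ 𝟙 ⌊ toℕ i ≟ a ⌋ * F (suc (toℕ i))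
    shift-down i = cong (λ b → 𝟙 b * F (suc (toℕ i))) (⌊≟⌋-suc (toℕ i) a)

∑-toℕ-+ : ∀ a b (h : ℕ → ℕ) → sum {a + b} (h ∘ toℕ) ≡ sum {a} (h ∘ toℕ) + sum {b} (λ v → h (a + toℕ v))
∑-toℕ-+ zero    b h = refl
∑-toℕ-+ (suc a) b h = trans (cong (h 0 +_) (∑-toℕ-+ a b (h ∘ suc))) (sym (+-assoc (h 0) _ _))

∑-toℕ-mono : ∀ {a b} (h : ℕ → ℕ) → a ≤ b → sum {a} (h ∘ toℕ) ≤ sum {b} (h ∘ toℕ)
∑-toℕ-mono {a} h a≤b with m≤n⇒∃[o]m+o≡n a≤b
... | d , refl = ≤-trans (m≤m+n _ _) (≤-reflexive (sym (∑-toℕ-+ a d h)))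

∑-toℕ-periodic : ∀ q r (h : ℕ → ℕ) → (∀ v → h (r + v) ≡ h v) → sum {q * r} (h ∘ toℕ) ≡ q * sum {r} (h ∘ toℕ)
∑-toℕ-periodic zero    r h _        = refl
∑-toℕ-periodic (suc q) r h periodic = begin
  sum {r + q * r} (h ∘ toℕ)
    ≡⟨ ∑-toℕ-+ r (q * r) h ⟩
  sum {r} (h ∘ toℕ) + sum {q * r} (λ v → h (r + toℕ v))
    ≡⟨ cong (sum {r} (h ∘ toℕ) +_) (sum-cong-≗ {q * r} (periodic ∘ toℕ)) ⟩
  sum {r} (h ∘ toℕ) + sum {q * r} (h ∘ toℕ)
    ≡⟨ cong (sum {r} (h ∘ toℕ) +_) (∑-toℕ-periodic q r h periodic) ⟩
  sum {r} (h ∘ toℕ) + q * sum {r} (h ∘ toℕ) ∎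
  where open ≡-Reasoning

-- Binomial coefficients

pascal : ∀ n k → suc n C suc k ≡ n C k + n C suc k
pascal n k = sym (nCk+nC[k+1]≡[n+1]C[k+1] n k)

C-monoˡ-≤ : ∀ k {m n} → m ≤ n → m C k ≤ n C k
C-monoˡ-≤ zero    _ = ≤-refl
C-monoˡ-≤ (suc k) {zero} _ = z≤n
C-monoˡ-≤ (suc k) {suc m} {suc n} (s≤s m≤n) = begin
  suc m C suc k      ≡⟨ pascal m k ⟩
  m C k + m C suc k  ≤⟨ +-mono-≤ (C-monoˡ-≤ k m≤n) (C-monoˡ-≤ (suc k) m≤n) ⟩
  n C k + n C suc k  ≡⟨ pascal n k ⟨
  suc n C suc k      ∎
  where open ≤-Reasoning

-- (k+1)·C(m,k+1) = (m−k)·C(m,k), arranged so that no subtraction occurs.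
C-absorption : ∀ m k → suc k * (m C suc k) + k * (m C k) ≡ m * (m C k)
C-absorption zero    zero    = refl
C-absorption zero    (suc k) = cong₂ _+_ (*-zeroʳ (suc (suc k))) (*-zeroʳ (suc k))
C-absorption (suc m) zero    = trans (+-identityʳ _) (trans (+-identityʳ _) (trans (nC1≡n (suc m)) (sym (*-identityʳ (suc m)))))
C-absorption (suc m) (suc k) = begin
  suc (suc k) * (suc m C suc (suc k)) + suc k * (suc m C suc k)
    ≡⟨ cong₂ (λ x y → suc (suc k) * x + suc k * y) (pascal m (suc k)) (pascal m k) ⟩
  suc (suc k) * (B + D) + suc k * (A + B)
    ≡⟨ regroup k A B D ⟩
  (suc (suc k) * D + suc k * B) + (suc k * B + k * A) + A + B
    ≡⟨ cong₂ (λ x y → x + y + A + B) (C-absorption m (suc k)) (C-absorption m k) ⟩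
  m * B + m * A + A + B
    ≡⟨ collect m A B ⟩
  suc m * (A + B)
    ≡⟨ cong (suc m *_) (pascal m k) ⟨
  suc m * (suc m C suc k) ∎
  where
    open ≡-Reasoning
    A = m C k
    B = m C suc k
    D = m C suc (suc k)
    regroup : ∀ k A B D → suc (suc k) * (B + D) + suc k * (A + B) ≡ (suc (suc k) * D + suc k * B) + (suc k * B + k * A) + A + B
    regroup = solve-∀
    collect : ∀ m A B → m * B + m * A + A + B ≡ suc m * (A + B)
    collect = solve-∀

scaled-C-absorption : ∀ m k b → suc k * (b * (m C suc k)) + b * k * (m C k) ≡ b * m * (m C k)
scaled-C-absorption m k b = begin
  suc k * (b * (m C suc k)) + b * k * (m C k) ≡⟨ distribute k b (m C suc k) (m C k) ⟩
  b * (suc k * (m C suc k) + k * (m C k))     ≡⟨ cong (b *_) (C-absorption m k) ⟩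
  b * (m * (m C k))                           ≡⟨ *-assoc b m (m C k) ⟨
  b * m * (m C k)                             ∎
  where
    open ≡-Reasoning
    distribute : ∀ k b x y → suc k * (b * x) + b * k * y ≡ b * (suc k * x + k * y)
    distribute = solve-∀

private
  expand : ∀ k a b y → (b * k + suc k * a) * y ≡ suc k * (a * y) + b * k * y
  expand = solve-∀

-- As C(m,k+1)/C(m,k) = (m−k)/(k+1), these compare that ratio with a/b.
C-suc-≤ : ∀ m k a b → b * m ≤ b * k + suc k * a → b * (m C suc k) ≤ a * (m C k)
C-suc-≤ m k a b bm≤ = *-cancelˡ-≤ (suc k) (+-cancelʳ-≤ (b * k * (m C k)) _ _ (begin
  suc k * (b * (m C suc k)) + b * k * (m C k) ≡⟨ scaled-C-absorption m k b ⟩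
  b * m * (m C k)                             ≤⟨ *-monoˡ-≤ (m C k) bm≤ ⟩
  (b * k + suc k * a) * (m C k)               ≡⟨ expand k a b (m C k) ⟩
  suc k * (a * (m C k)) + b * k * (m C k)     ∎))
  where open ≤-Reasoning

C-suc-≥ : ∀ m k a b → b * k + suc k * a ≤ b * m → a * (m C k) ≤ b * (m C suc k)
C-suc-≥ m k a b ≤bm = *-cancelˡ-≤ (suc k) (+-cancelʳ-≤ (b * k * (m C k)) _ _ (begin
  suc k * (a * (m C k)) + b * k * (m C k)     ≡⟨ expand k a b (m C k) ⟨
  (b * k + suc k * a) * (m C k)               ≤⟨ *-monoˡ-≤ (m C k) ≤bm ⟩
  b * m * (m C k)                             ≡⟨ scaled-C-absorption m k b ⟨
  suc k * (b * (m C suc k)) + b * k * (m C k) ∎))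
  where open ≤-Reasoning

-- Supporting lines of discrete concave functions

ConcaveAt : (ℕ → ℕ) → ℕ → Set
ConcaveAt g j = g (2 + j) + g j ≤ g (1 + j) + g (1 + j)

FallingAt : (ℕ → ℕ) → ℕ → Set
FallingAt g j = g (suc j) ≤ g j

-- The slope is a truncated
-- difference, made exact by rising.
module SupportingLine (g : ℕ → ℕ) (n q : ℕ)
  (rising : g q ≤ g (suc q))
  (concave-below : ∀ j → suc j ≤ q → ConcaveAt g j)
  (concave-or-falling-above : ∀ j → q ≤ j → 2 + j ≤ n → ConcaveAt g j ⊎ FallingAt g (suc j))
  where

  slope : ℕ
  slope = g (suc q) ∸ g q

  g-step : g q + slope ≡ g (suc q)
  g-step = m+[n∸m]≡n rising

  slope-below : ∀ j d → j + d ≡ q → g j + slope ≤ g (suc j)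
  slope-below j zero    j+0≡q = subst (λ x → g x + slope ≤ g (suc x)) (sym j≡q) (≤-reflexive g-step)
    where j≡q = trans (sym (+-identityʳ j)) j+0≡q
  slope-below j (suc d) j+d≡q = +-cancelʳ-≤ (g (suc j)) _ _ (begin
    g j + slope + g (suc j)     ≡⟨ +-assoc (g j) slope (g (suc j)) ⟩
    g j + (slope + g (suc j))   ≡⟨ cong (g j +_) (+-comm slope (g (suc j))) ⟩
    g j + (g (suc j) + slope)   ≤⟨ +-monoʳ-≤ (g j) (slope-below (suc j) d 1+j+d≡q) ⟩
    g j + g (2 + j)             ≡⟨ +-comm (g j) (g (2 + j)) ⟩
    g (2 + j) + g j             ≤⟨ concave-below j (≤-trans (m≤m+n (suc j) d) (≤-reflexive 1+j+d≡q)) ⟩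
    g (suc j) + g (suc j)       ∎)
    where
      open ≤-Reasoning
      1+j+d≡q = trans (sym (+-suc j d)) j+d≡q

  chord-below : ∀ x d → x + d ≡ q → g x + d * slope ≤ g q
  chord-below x zero    x+0≡q = subst (λ y → g x + 0 ≤ g y) x≡q (≤-reflexive (+-identityʳ (g x)))
    where x≡q = trans (sym (+-identityʳ x)) x+0≡q
  chord-below x (suc d) x+d≡q = begin
    g x + (slope + d * slope)   ≡⟨ +-assoc (g x) slope (d * slope) ⟨
    g x + slope + d * slope     ≤⟨ +-monoˡ-≤ (d * slope) (slope-below x (suc d) x+d≡q) ⟩
    g (suc x) + d * slope       ≤⟨ chord-below (suc x) d (trans (sym (+-suc x d)) x+d≡q) ⟩
    g q                         ∎
    where open ≤-Reasoning

  slope-above : ∀ d → suc (q + d) ≤ n → g (suc (q + d)) ≤ g (q + d) + slope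
  slope-above zero    _ rewrite +-identityʳ q = ≤-reflexive (sym g-step)
  slope-above (suc d) q+d+2≤n rewrite +-suc q d
    with concave-or-falling-above (q + d) (m≤m+n q d) q+d+2≤n
  ... | inj₁ concave = +-cancelʳ-≤ (g j) _ _ (begin
    g (2 + j) + g j             ≤⟨ concave ⟩
    g (suc j) + g (suc j)       ≤⟨ +-monoʳ-≤ (g (suc j)) (slope-above d (≤-trans (n≤1+n _) q+d+2≤n)) ⟩
    g (suc j) + (g j + slope)   ≡⟨ cong (g (suc j) +_) (+-comm (g j) slope) ⟩
    g (suc j) + (slope + g j)   ≡⟨ +-assoc (g (suc j)) slope (g j) ⟨
    g (suc j) + slope + g j     ∎)
    where
      open ≤-Reasoning
      j = q + d
  ... | inj₂ falling = ≤-trans falling (m≤m+n _ slope)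

  chord-above : ∀ d → q + d ≤ n → g (q + d) ≤ g q + d * slope
  chord-above zero    _ rewrite +-identityʳ q | +-identityʳ (g q) = ≤-refl
  chord-above (suc d) q+d<n rewrite +-suc q d = begin
    g (suc (q + d))             ≤⟨ slope-above d q+d<n ⟩
    g (q + d) + slope           ≤⟨ +-monoˡ-≤ slope (chord-above d (≤-trans (n≤1+n _) q+d<n)) ⟩
    g q + d * slope + slope     ≡⟨ +-assoc (g q) (d * slope) slope ⟩
    g q + (d * slope + slope)   ≡⟨ cong (g q +_) (+-comm (d * slope) slope) ⟩
    g q + (slope + d * slope)   ∎
    where open ≤-Reasoning

  supporting-line : ∀ x → x ≤ n → g x + q * slope ≤ g q + x * slope
  supporting-line x x≤n with ≤-total x q
  ... | inj₁ x≤q with m≤n⇒∃[o]m+o≡n x≤q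
  ...   | d , refl = begin
    g x + (x + d) * slope       ≡⟨ shuffle (g x) x d slope ⟩
    g x + d * slope + x * slope ≤⟨ +-monoˡ-≤ (x * slope) (chord-below x d refl) ⟩
    g (x + d) + x * slope       ∎
    where
      open ≤-Reasoning
      shuffle : ∀ a x d s → a + (x + d) * s ≡ a + d * s + x * s
      shuffle = solve-∀
  supporting-line x x≤n | inj₂ q≤x with m≤n⇒∃[o]m+o≡n q≤x
  ...   | d , refl = begin
    g (q + d) + q * slope       ≤⟨ +-monoˡ-≤ (q * slope) (chord-above d x≤n) ⟩
    g q + d * slope + q * slope ≡⟨ shuffle (g q) q d slope ⟩
    g q + (q + d) * slope       ∎
    where
      open ≤-Reasoning
      shuffle : ∀ a q d s → a + d * s + q * s ≡ a + (q + d) * s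
      shuffle = solve-∀

  supporting-line-tight : ∀ x → x ≡ q ⊎ x ≡ suc q → g x + q * slope ≡ g q + x * slope
  supporting-line-tight x (inj₁ refl) = refl
  supporting-line-tight x (inj₂ refl) = begin
    g (suc q) + q * slope       ≡⟨ cong (_+ q * slope) g-step ⟨
    g q + slope + q * slope     ≡⟨ +-assoc (g q) slope (q * slope) ⟩
    g q + suc q * slope         ∎
    where open ≡-Reasoning

  balanced-maximises : ∀ {r} (a t : Fin r → ℕ) → (∀ i → a i ≤ n) → (∀ i → t i ≡ q ⊎ t i ≡ suc q) →
                       sum a ≡ sum t → sum (g ∘ a) ≤ sum (g ∘ t)
  balanced-maximises {r} a t a≤n t-balanced ∑a≡∑t = +-cancelʳ-≤ X _ _ (begin
    sum (g ∘ a) + X                           ≡⟨ ∑-distrib-+ (g ∘ a) _ ⟨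
    sum (λ i → g (a i) + q * slope)           ≤⟨ ∑-mono-≤ (λ i → supporting-line (a i) (a≤n i)) ⟩
    sum (λ i → g q + a i * slope)             ≡⟨ ∑-distrib-+ (λ _ → g q) (λ i → a i * slope) ⟩
    Y + sum (λ i → a i * slope)               ≡⟨ cong (Y +_) (∑-*ʳ a slope) ⟩
    Y + sum a * slope                         ≡⟨ cong (λ s → Y + s * slope) ∑a≡∑t ⟩
    Y + sum t * slope                         ≡⟨ cong (Y +_) (∑-*ʳ t slope) ⟨
    Y + sum (λ i → t i * slope)               ≡⟨ ∑-distrib-+ _ (λ i → t i * slope) ⟨
    sum (λ i → g q + t i * slope)             ≡⟨ sum-cong-≗ (λ i → supporting-line-tight (t i) (t-balanced i)) ⟨
    sum (λ i → g (t i) + q * slope)           ≡⟨ ∑-distrib-+ (g ∘ t) _ ⟩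
    sum (g ∘ t) + X                           ∎)
    where
      open ≤-Reasoning
      X = sum {r} (λ _ → q * slope)
      Y = sum {r} (λ _ → g q)

-- Parts of a complete multipartite graph

-- In a complete multipartite graph on n vertices, the a vertices of a part of size a
-- have degree n − a, so together they contribute a·C(n − a, k) to eφ.
partWeight : ℕ → ℕ → ℕ → ℕ
partWeight k n a = a * ((n ∸ a) C k)

partWeight-split : ∀ k a m {n} → a + m ≡ n → partWeight k n a ≡ a * (m C k)
partWeight-split k a m refl = cong (λ x → a * (x C k)) (m+n∸m≡n a m)

partWeight-falling : ∀ k {n i} → suc i ≤ n → suc n ≤ suc (suc k) * suc i → FallingAt (partWeight (suc k) n) i
partWeight-falling k {n} {i} i<n n< with m≤n⇒∃[o]m+o≡n i<n
... | m , refl = begin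
  partWeight (suc k) n (suc i)      ≡⟨ partWeight-split (suc k) (suc i) m refl ⟩
  suc i * (m C suc k)               ≤⟨ +-monoˡ-≤ (i * (m C suc k)) ratio ⟩
  i * (m C k) + i * (m C suc k)     ≡⟨ *-distribˡ-+ i (m C k) (m C suc k) ⟨
  i * (m C k + m C suc k)           ≡⟨ cong (i *_) (pascal m k) ⟨
  i * (suc m C suc k)               ≡⟨ partWeight-split (suc k) i (suc m) (+-suc i m) ⟨
  partWeight (suc k) n i            ∎
  where
    open ≤-Reasoning
    ratio : m C suc k ≤ i * (m C k)
    ratio = subst (_≤ i * (m C k)) (*-identityˡ _) (C-suc-≤ m k i 1 (+-cancelʳ-≤ (suc (suc i)) _ _
      (subst₂ _≤_ (shiftₗ i m k) (shiftᵣ i k) n<)))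
      where
        shiftₗ : ∀ i m k → suc (suc i + m) ≡ 1 * m + suc (suc i)
        shiftₗ = solve-∀
        shiftᵣ : ∀ i k → suc (suc k) * suc i ≡ (1 * k + suc k * i) + suc (suc i)
        shiftᵣ = solve-∀

small-part<n : ∀ k {n q} → suc (suc k) * suc q ≤ suc n → suc q ≤ n
small-part<n k {n} {q} n≥ = ≤-pred (≤-trans (m≤m+n (suc (suc q)) (q + k * suc q)) (subst (_≤ suc n) (unfold k q) n≥))
  where
    unfold : ∀ k q → suc (suc k) * suc q ≡ suc (suc q) + (q + k * suc q)
    unfold = solve-∀

partWeight-rising : ∀ k {n q} → suc (suc k) * suc q ≤ suc n →
                    partWeight (suc k) n q ≤ partWeight (suc k) n (suc q)
partWeight-rising k {n} {q} n≥ with m≤n⇒∃[o]m+o≡n (small-part<n k n≥)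
... | m , refl = begin
  partWeight (suc k) n q            ≡⟨ partWeight-split (suc k) q (suc m) (+-suc q m) ⟩
  q * (suc m C suc k)               ≡⟨ cong (q *_) (pascal m k) ⟩
  q * (m C k + m C suc k)           ≡⟨ *-distribˡ-+ q (m C k) (m C suc k) ⟩
  q * (m C k) + q * (m C suc k)     ≤⟨ +-monoˡ-≤ (q * (m C suc k)) ratio ⟩
  suc q * (m C suc k)               ≡⟨ partWeight-split (suc k) (suc q) m refl ⟨
  partWeight (suc k) n (suc q)      ∎
  where
    open ≤-Reasoning
    ratio : q * (m C k) ≤ m C suc k
    ratio = subst (q * (m C k) ≤_) (*-identityˡ _) (C-suc-≥ m k q 1 (+-cancelʳ-≤ (suc (suc q)) _ _
      (subst₂ _≤_ (shiftₗ k q) (shiftᵣ q m) n≥)))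
      where
        shiftₗ : ∀ k q → suc (suc k) * suc q ≡ (1 * k + suc k * q) + suc (suc q)
        shiftₗ = solve-∀
        shiftᵣ : ∀ q m → suc (suc q + m) ≡ 1 * m + suc (suc q)
        shiftᵣ = solve-∀

-- Expanding with Pascal's rule, the second difference of a ↦ a·C(n − a, k+1) at a = 1 + i,
-- where n = 2 + i + p, is 2·C(p,k) − i·C(p,k−1).
C-concave : ∀ k i p → suc (suc k) * suc i + suc k ≤ suc (2 * (2 + i + p)) →
            (2 + i) * (p C suc k) + i * ((2 + p) C suc k) ≤ (1 + i) * ((1 + p) C suc k) + (1 + i) * ((1 + p) C suc k)
C-concave zero i p _ = begin
  (2 + i) * (p C 1) + i * ((2 + p) C 1)             ≡⟨ cong₂ (λ x y → (2 + i) * x + i * y) (nC1≡n p) (nC1≡n (2 + p)) ⟩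
  (2 + i) * p + i * (2 + p)                         ≤⟨ m≤m+n _ 2 ⟩
  (2 + i) * p + i * (2 + p) + 2                     ≡⟨ quadratic i p ⟩
  (1 + i) * (1 + p) + (1 + i) * (1 + p)             ≡⟨ cong (λ x → (1 + i) * x + (1 + i) * x) (nC1≡n (1 + p)) ⟨
  (1 + i) * ((1 + p) C 1) + (1 + i) * ((1 + p) C 1) ∎
  where
    open ≤-Reasoning
    quadratic : ∀ i p → (2 + i) * p + i * (2 + p) + 2 ≡ (1 + i) * (1 + p) + (1 + i) * (1 + p)
    quadratic = solve-∀
C-concave (suc t) i p n≥ = begin
  (2 + i) * A + i * ((2 + p) C suc (suc t))
    ≡⟨ cong (λ x → (2 + i) * A + i * x) (trans (pascal (suc p) (suc t)) (cong₂ _+_ (pascal p t) (pascal p (suc t)))) ⟩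
  (2 + i) * A + i * ((D + B) + (B + A))
    ≡⟨ regroup i A B D ⟩
  E + i * D
    ≤⟨ +-monoʳ-≤ E ratio ⟩
  E + 2 * B
    ≡⟨ collect i A B ⟩
  (1 + i) * (B + A) + (1 + i) * (B + A)
    ≡⟨ cong (λ x → (1 + i) * x + (1 + i) * x) (pascal p (suc t)) ⟨
  (1 + i) * ((1 + p) C suc (suc t)) + (1 + i) * ((1 + p) C suc (suc t)) ∎
  where
    open ≤-Reasoning
    A = p C suc (suc t)
    B = p C suc t
    D = p C t
    E = (2 + 2 * i) * A + 2 * i * B
    regroup : ∀ i A B D → (2 + i) * A + i * ((D + B) + (B + A)) ≡ (2 + 2 * i) * A + 2 * i * B + i * D
    regroup = solve-∀
    collect : ∀ i A B → (2 + 2 * i) * A + 2 * i * B + 2 * B ≡ (1 + i) * (B + A) + (1 + i) * (B + A)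
    collect = solve-∀
    ratio : i * D ≤ 2 * B
    ratio = C-suc-≥ p t i 2 (+-cancelʳ-≤ (2 * i + 5) _ _ (subst₂ _≤_ (shiftₗ t i) (shiftᵣ i p) n≥))
      where
        shiftₗ : ∀ t i → suc (suc (suc t)) * suc i + suc (suc t) ≡ (2 * t + suc t * i) + (2 * i + 5)
        shiftₗ = solve-∀
        shiftᵣ : ∀ i p → suc (2 * (2 + i + p)) ≡ 2 * p + (2 * i + 5)
        shiftᵣ = solve-∀

partWeight-concave : ∀ k {n i} → 2 + i ≤ n → suc (suc k) * suc i + suc k ≤ suc (2 * n) →
                     ConcaveAt (partWeight (suc k) n) i
partWeight-concave k {n} {i} i+2≤n n≥ with m≤n⇒∃[o]m+o≡n i+2≤n
... | p , refl = begin
  partWeight (suc k) n (2 + i) + partWeight (suc k) n i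
    ≡⟨ cong₂ _+_ (partWeight-split (suc k) (2 + i) p refl)
                 (partWeight-split (suc k) i (2 + p) (trans (+-suc i (suc p)) (cong suc (+-suc i p)))) ⟩
  (2 + i) * (p C suc k) + i * ((2 + p) C suc k)
    ≤⟨ C-concave k i p n≥ ⟩
  (1 + i) * ((1 + p) C suc k) + (1 + i) * ((1 + p) C suc k)
    ≡⟨ cong (λ x → x + x) (partWeight-split (suc k) (1 + i) (1 + p) (+-suc (suc i) p)) ⟨
  partWeight (suc k) n (1 + i) + partWeight (suc k) n (1 + i) ∎
  where open ≤-Reasoning

partWeight-balanced-maximises : ∀ k {n q r} → suc (suc k) * suc q ≤ suc n →
  (a t : Fin r → ℕ) → (∀ i → a i ≤ n) → (∀ i → t i ≡ q ⊎ t i ≡ suc q) → sum a ≡ sum t →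
  sum (partWeight (suc k) n ∘ a) ≤ sum (partWeight (suc k) n ∘ t)
partWeight-balanced-maximises k {n} {q} q-small =
  SupportingLine.balanced-maximises (partWeight (suc k) n) n q
    (partWeight-rising k q-small) concave-below (λ j _ → concave-or-falling j)
  where
    K = suc (suc k)
    next : ∀ j → K * suc j + suc k < K * suc (suc j)
    next j = ≤-reflexive (step k j)
      where
        step : ∀ k j → suc (suc (suc k) * suc j + suc k) ≡ suc (suc k) * suc (suc j)
        step = solve-∀
    n≤2n : ∀ n → n ≤ 2 * n
    n≤2n n = m≤m+n n (n + 0)
    concave-below : ∀ j → suc j ≤ q → ConcaveAt (partWeight (suc k) n) j
    concave-below j j<q = partWeight-concave k (≤-trans (s≤s j<q) (small-part<n k q-small))
      (≤-trans (<⇒≤ (next j)) (≤-trans (*-monoʳ-≤ K (s≤s j<q)) (≤-trans q-small (s≤s (n≤2n n)))))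
    concave-or-falling : ∀ j → 2 + j ≤ n → ConcaveAt (partWeight (suc k) n) j ⊎ FallingAt (partWeight (suc k) n) (suc j)
    concave-or-falling j j+2≤n with K * suc j + suc k ≤? suc (2 * n)
    ... | yes small = inj₁ (partWeight-concave k j+2≤n small)
    -- Outside the concave range, 2n + 2 ≤ (k+2)(j+1) + k + 1 < (k+2)(j+2), so the weight falls.
    ... | no  large = inj₂ (partWeight-falling k j+2≤n
                              (≤-trans (s≤s (≤-trans (n≤2n n) (n≤1+n _))) (≤-trans (≰⇒> large) (<⇒≤ (next j)))))

quotient-part-small : ∀ {k n r} .{{_ : NonZero r}} → k + 2 ≤ r → k * r ≤ n → suc k * suc (n / r) ≤ suc n
quotient-part-small {k} {n} {r} k+2≤r kr≤n = begin
  suc k * suc q          ≡⟨ peel k q ⟩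
  suc k * q + suc k      ≤⟨ +-monoʳ-≤ (suc k * q) (s≤s k≤q) ⟩
  suc k * q + suc q      ≡⟨ gather k q ⟩
  suc ((k + 2) * q)      ≤⟨ s≤s (*-monoˡ-≤ q k+2≤r) ⟩
  suc (r * q)            ≤⟨ s≤s (≤-trans (≤-reflexive (*-comm r q)) (m/n*n≤m n r)) ⟩
  suc n                  ∎
  where
    open ≤-Reasoning
    q = n / r
    k≤q : k ≤ q
    k≤q = subst (_≤ q) (m*n/n≡m k r) (/-monoˡ-≤ r kr≤n)
    peel : ∀ k q → suc k * suc q ≡ suc k * q + suc k
    peel = solve-∀
    gather : ∀ k q → suc k * q + suc q ≡ suc ((k + 2) * q)
    gather = solve-∀

crossDegreeIn : ∀ {n} → (Fin n → Bool) → (Fin n → ℕ) → Fin n → ℕ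
crossDegreeIn S c v = sum (λ u → 𝟙 (S u ∧ not ⌊ c v ≟ c u ⌋))

classSize : ∀ {n} → (Fin n → ℕ) → ℕ → ℕ
classSize c a = sum (λ v → 𝟙 ⌊ a ≟ c v ⌋)

∑-by-colour : ∀ {n} r (c : Fin n → ℕ) → (∀ v → c v < r) → (F : ℕ → ℕ) →
              sum (λ v → F (c v)) ≡ sum {r} (λ i → classSize c (toℕ i) * F (toℕ i))
∑-by-colour {n} r c c<r F = begin
  sum (λ v → F (c v))
    ≡⟨ sum-cong-≗ {n} (λ v → ∑-select F (c v) (c<r v)) ⟨
  sum (λ v → sum {r} (λ i → 𝟙 ⌊ toℕ i ≟ c v ⌋ * F (toℕ i)))
    ≡⟨ ∑-comm {n} {r} (λ v i → 𝟙 ⌊ toℕ i ≟ c v ⌋ * F (toℕ i)) ⟩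
  sum {r} (λ i → sum (λ v → 𝟙 ⌊ toℕ i ≟ c v ⌋ * F (toℕ i)))
    ≡⟨ sum-cong-≗ {r} (λ i → ∑-*ʳ (λ v → 𝟙 ⌊ toℕ i ≟ c v ⌋) (F (toℕ i))) ⟩
  sum {r} (λ i → classSize c (toℕ i) * F (toℕ i)) ∎
  where open ≡-Reasoning

∑-classSize : ∀ {n} r (c : Fin n → ℕ) → (∀ v → c v < r) → sum {r} (classSize c ∘ toℕ) ≡ n
∑-classSize {n} r c c<r = begin
  sum {r} (classSize c ∘ toℕ)                   ≡⟨ sum-cong-≗ {r} (λ i → *-identityʳ (classSize c (toℕ i))) ⟨
  sum {r} (λ i → classSize c (toℕ i) * 1)       ≡⟨ ∑-by-colour r c c<r (λ _ → 1) ⟨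
  sum {n} (λ _ → 1)                             ≡⟨ ∑-const n 1 ⟩
  n * 1                                         ≡⟨ *-identityʳ n ⟩
  n                                             ∎
  where open ≡-Reasoning

classSize≤n : ∀ {n} (c : Fin n → ℕ) a → classSize c a ≤ n
classSize≤n {n} c a =
  ≤-trans (∑-mono-≤ (λ v → 𝟙≤1 ⌊ a ≟ c v ⌋)) (≤-reflexive (trans (∑-const n 1) (*-identityʳ n)))

crossDegree+classSize : ∀ {n} (c : Fin n → ℕ) v → crossDegreeIn (λ _ → true) c v + classSize c (c v) ≡ n
crossDegree+classSize {n} c v = begin
  crossDegreeIn (λ _ → true) c v + classSize c (c v)
    ≡⟨ ∑-distrib-+ (λ u → 𝟙 (not ⌊ c v ≟ c u ⌋)) (λ u → 𝟙 ⌊ c v ≟ c u ⌋) ⟨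
  sum (λ u → 𝟙 (not ⌊ c v ≟ c u ⌋) + 𝟙 ⌊ c v ≟ c u ⌋)  ≡⟨ sum-cong-≗ (λ u → 𝟙-not ⌊ c v ≟ c u ⌋) ⟩
  sum {n} (λ _ → 1)                                      ≡⟨ ∑-const n 1 ⟩
  n * 1                                                  ≡⟨ *-identityʳ n ⟩
  n                                                      ∎
  where open ≡-Reasoning

eφ-multipartite : ∀ k {n} r (c : Fin n → ℕ) → (∀ v → c v < r) →
  sum (λ v → crossDegreeIn (λ _ → true) c v C k) ≡ sum {r} (λ i → partWeight k n (classSize c (toℕ i)))
eφ-multipartite k {n} r c c<r = begin
  sum (λ v → crossDegreeIn (λ _ → true) c v C k)       ≡⟨ sum-cong-≗ (λ v → cong (_C k) (crossDegree≡n∸classSize v)) ⟩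
  sum (λ v → (n ∸ classSize c (c v)) C k)              ≡⟨ ∑-by-colour r c c<r (λ a → (n ∸ classSize c a) C k) ⟩
  sum {r} (λ i → partWeight k n (classSize c (toℕ i))) ∎
  where
    open ≡-Reasoning
    crossDegree≡n∸classSize : ∀ v → crossDegreeIn (λ _ → true) c v ≡ n ∸ classSize c (c v)
    crossDegree≡n∸classSize v =
      trans (sym (m+n∸n≡m _ (classSize c (c v)))) (cong (_∸ classSize c (c v)) (crossDegree+classSize c v))

-- Degree majorisation

argmax-in : ∀ {n} (S : Fin n → Bool) (f : Fin n → ℕ) →
            (∀ v → S v ≡ false) ⊎ Σ (Fin n) (λ x → S x ≡ true × (∀ v → S v ≡ true → f v ≤ f x))
argmax-in {zero}  S f = inj₁ (λ ())
argmax-in {suc n} S f with argmax-in (S ∘ suc) (f ∘ suc) | S zero in S0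
... | inj₁ empty | false = inj₁ λ { zero → S0 ; (suc v) → empty v }
... | inj₁ empty | true  = inj₂ (zero , S0 , λ { zero _ → ≤-refl
                                              ; (suc v) Sv → ⊥-elim (true≢false (trans (sym Sv) (empty v))) })
... | inj₂ (x , Sx , max) | false = inj₂ (suc x , Sx , λ { zero Sv → ⊥-elim (true≢false (trans (sym Sv) S0))
                                                        ; (suc v) Sv → max v Sv })
... | inj₂ (x , Sx , max) | true with f zero ≤? f (suc x)
...   | yes f0≤fx = inj₂ (suc x , Sx , λ { zero _ → f0≤fx ; (suc v) Sv → max v Sv })
...   | no  f0≰fx = inj₂ (zero , S0 , λ { zero _ → ≤-refl ; (suc v) Sv → ≤-trans (max v Sv) (<⇒≤ (≰⇒> f0≰fx)) })

𝟙-∧-split : ∀ s t e → 𝟙 (s ∧ e) ≤ 𝟙 ((s ∧ t) ∧ e) + 𝟙 (s ∧ not (s ∧ t))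
𝟙-∧-split false t     e = z≤n
𝟙-∧-split true  true  e = ≤-reflexive (sym (+-identityʳ _))
𝟙-∧-split true  false e = 𝟙≤1 e

𝟙-recolour-inside : ∀ r s t cv cu → cv < r →
  𝟙 ((s ∧ t) ∧ not ⌊ cv ≟ cu ⌋) + 𝟙 (s ∧ not (s ∧ t)) ≡ 𝟙 (s ∧ not ⌊ cv ≟ (if s ∧ t then cu else r) ⌋)
𝟙-recolour-inside r false t     cv cu _    = refl
𝟙-recolour-inside r true  true  cv cu _    = +-identityʳ _
𝟙-recolour-inside r true  false cv cu cv<r rewrite ⌊≟⌋-≢ (<⇒≢ cv<r) = refl

𝟙-recolour-outside : ∀ r s t cu → (s ∧ t ≡ true → cu < r) →
  𝟙 (s ∧ not ⌊ r ≟ (if s ∧ t then cu else r) ⌋) ≡ 𝟙 (s ∧ t)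
𝟙-recolour-outside r false t     cu _    = refl
𝟙-recolour-outside r true  true  cu cu<r rewrite ⌊≟⌋-≢ (≢-sym (<⇒≢ (cu<r refl))) = refl
𝟙-recolour-outside r true  false cu _    rewrite ⌊≟⌋-refl r = refl

module _ {n} (G : Graph n) where

  CliqueFreeIn : ℕ → (Fin n → Bool) → Set
  CliqueFreeIn m S = (f : Fin m → Fin n) → Injective _≡_ _≡_ f → (∀ i → S (f i) ≡ true) →
                     (∀ i j → i ≢ j → adj G (f i) (f j) ≡ true) → ⊥

  degreeIn : (Fin n → Bool) → Fin n → ℕ
  degreeIn S v = sum (λ u → 𝟙 (S u ∧ adj G v u))

  neighbourhoodIn : (Fin n → Bool) → Fin n → Fin n → Bool
  neighbourhoodIn S x u = S u ∧ adj G x u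

  neighbourhood-cliqueFree : ∀ {m S x} → S x ≡ true → CliqueFreeIn (suc m) S →
                             CliqueFreeIn m (neighbourhoodIn S x)
  neighbourhood-cliqueFree {m} {S} {x} Sx free f f-inj f-in f-clique = free f⁺ f⁺-inj f⁺-in f⁺-clique
    where
      x∉N : ∀ {u} → neighbourhoodIn S x u ≡ true → x ≢ u
      x∉N {u} Nu refl = true≢false (trans (sym (∧-conicalʳ (S x) _ Nu)) (irrefl G x))
      f⁺ : Fin (suc m) → Fin n
      f⁺ zero    = x
      f⁺ (suc i) = f i
      f⁺-inj : Injective _≡_ _≡_ f⁺
      f⁺-inj {zero}  {zero}  _ = refl
      f⁺-inj {zero}  {suc j} e = ⊥-elim (x∉N (f-in j) e)
      f⁺-inj {suc i} {zero}  e = ⊥-elim (x∉N (f-in i) (sym e))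
      f⁺-inj {suc i} {suc j} e = cong suc (f-inj e)
      f⁺-in : ∀ i → S (f⁺ i) ≡ true
      f⁺-in zero    = Sx
      f⁺-in (suc i) = ∧-conicalˡ _ _ (f-in i)
      f⁺-clique : ∀ i j → i ≢ j → adj G (f⁺ i) (f⁺ j) ≡ true
      f⁺-clique zero    zero    i≢j = ⊥-elim (i≢j refl)
      f⁺-clique zero    (suc j) _   = ∧-conicalʳ (S (f j)) _ (f-in j)
      f⁺-clique (suc i) zero    _   = trans (Defs.sym G (f i) x) (∧-conicalʳ (S (f i)) _ (f-in i))
      f⁺-clique (suc i) (suc j) i≢j = f-clique i j (λ e → i≢j (cong suc e))

  -- Colours are bounded only on S: for r = 0 the vertices outside S could not be coloured from Fin r.
  Majorising : ℕ → (Fin n → Bool) → Set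
  Majorising r S = Σ (Fin n → ℕ) λ c → (∀ v → S v ≡ true → c v < r) ×
                                       (∀ v → S v ≡ true → degreeIn S v ≤ crossDegreeIn S c v)

  majorising-empty : ∀ {r S} → (∀ v → S v ≢ true) → Majorising r S
  majorising-empty S-empty = (λ _ → 0) , (λ v Sv → ⊥-elim (S-empty v Sv)) , (λ v Sv → ⊥-elim (S-empty v Sv))

  module Recolouring (r : ℕ) (S : Fin n → Bool) (x : Fin n) (c′ : Fin n → ℕ)
                     (c′<r : ∀ v → neighbourhoodIn S x v ≡ true → c′ v < r) where

    T : Fin n → Bool
    T = neighbourhoodIn S x

    c : Fin n → ℕ
    c u = if T u then c′ u else r

    c-inside : ∀ {v} → T v ≡ true → c v ≡ c′ v
    c-inside Tv = cong (λ b → if b then c′ _ else r) Tv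

    c-outside : ∀ {v} → T v ≡ false → c v ≡ r
    c-outside Tv = cong (λ b → if b then c′ _ else r) Tv

    c<r : ∀ v → c v < suc r
    c<r v with T v in Tv
    ... | true  = m<n⇒m<1+n (c′<r v Tv)
    ... | false = n<1+n r

    crossDegree-at : ∀ v a → c v ≡ a → crossDegreeIn S c v ≡ sum (λ u → 𝟙 (S u ∧ not ⌊ a ≟ c u ⌋))
    crossDegree-at v a refl = refl

    dominated-inside : ∀ v → T v ≡ true → degreeIn T v ≤ crossDegreeIn T c′ v → degreeIn S v ≤ crossDegreeIn S c v
    dominated-inside v Tv dominated-in-T = begin
      degreeIn S v
        ≤⟨ ∑-mono-≤ (λ u → 𝟙-∧-split (S u) (adj G x u) (adj G v u)) ⟩
      sum (λ u → 𝟙 (T u ∧ adj G v u) + 𝟙 (S u ∧ not (T u)))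
        ≡⟨ ∑-distrib-+ (λ u → 𝟙 (T u ∧ adj G v u)) outsideᶠ ⟩
      degreeIn T v + outside
        ≤⟨ +-monoˡ-≤ outside dominated-in-T ⟩
      crossDegreeIn T c′ v + outside
        ≡⟨ ∑-distrib-+ (λ u → 𝟙 (T u ∧ not ⌊ c′ v ≟ c′ u ⌋)) outsideᶠ ⟨
      sum (λ u → 𝟙 (T u ∧ not ⌊ c′ v ≟ c′ u ⌋) + 𝟙 (S u ∧ not (T u)))
        ≡⟨ sum-cong-≗ (λ u → 𝟙-recolour-inside r (S u) (adj G x u) (c′ v) (c′ u) (c′<r v Tv)) ⟩
      sum (λ u → 𝟙 (S u ∧ not ⌊ c′ v ≟ c u ⌋))
        ≡⟨ crossDegree-at v (c′ v) (c-inside Tv) ⟨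
      crossDegreeIn S c v ∎
      where
        open ≤-Reasoning
        outsideᶠ : Fin n → ℕ
        outsideᶠ u = 𝟙 (S u ∧ not (T u))
        outside = sum outsideᶠ

    dominated-outside : ∀ v → T v ≡ false → degreeIn S v ≤ degreeIn S x → degreeIn S v ≤ crossDegreeIn S c v
    dominated-outside v Tv v≤x = begin
      degreeIn S v
        ≤⟨ v≤x ⟩
      sum (λ u → 𝟙 (T u))
        ≡⟨ sum-cong-≗ (λ u → 𝟙-recolour-outside r (S u) (adj G x u) (c′ u) (c′<r u)) ⟨
      sum (λ u → 𝟙 (S u ∧ not ⌊ r ≟ c u ⌋))
        ≡⟨ crossDegree-at v r (c-outside Tv) ⟨
      crossDegreeIn S c v ∎
      where open ≤-Reasoning

    dominated : ∀ v → (T v ≡ true → degreeIn T v ≤ crossDegreeIn T c′ v) → degreeIn S v ≤ degreeIn S x →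
                degreeIn S v ≤ crossDegreeIn S c v
    dominated v inside v≤x = by-membership (T v) refl
      where
        by-membership : ∀ b → T v ≡ b → degreeIn S v ≤ crossDegreeIn S c v
        by-membership true  Tv = dominated-inside v Tv (inside Tv)
        by-membership false Tv = dominated-outside v Tv v≤x

  -- Giving colour r to a vertex x of maximal degree, and to everything outside its K_r-free
  -- neighbourhood T, vertices outside T see |T| = deg x vertices of other colours, and those
  -- inside T gain all of S ∖ T.
  degree-majorisation : ∀ r S → CliqueFreeIn (suc r) S → Majorising r S
  degree-majorisation zero S free =
    majorising-empty (λ v Sv → free (λ _ → v) (λ { {zero} {zero} _ → refl }) (λ _ → Sv)
                                    (λ { zero zero i≢j → ⊥-elim (i≢j refl) }))
  degree-majorisation (suc r) S free with argmax-in S (degreeIn S)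
  ... | inj₁ S-empty = majorising-empty (λ v Sv → true≢false (trans (sym Sv) (S-empty v)))
  ... | inj₂ (x , Sx , x-max) =
    c , (λ v _ → c<r v) , (λ v Sv → dominated v (proj₂ (proj₂ IH) v) (x-max v Sv))
    where
      IH = degree-majorisation r (neighbourhoodIn S x) (neighbourhood-cliqueFree Sx free)
      open Recolouring r S x (proj₁ IH) (proj₁ (proj₂ IH))

-- Turán graphs

eφ-as-sum : ∀ k {n} (G : Graph n) → eφ k G ≡ sum (λ v → degreeIn G (λ _ → true) v C k)
eφ-as-sum k {n} G = trans (sum-allFin (λ v → degree G v C k))
                          (sum-cong-≗ (λ v → cong (_C k) (sum-allFin (λ u → 𝟙 (adj G v u)))))
  where
    sum-tabulate : ∀ {m} (f : Fin m → ℕ) → L.sum (tabulate f) ≡ sum f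
    sum-tabulate {zero}  f = refl
    sum-tabulate {suc m} f = cong (f zero +_) (sum-tabulate (f ∘ suc))
    sum-allFin : ∀ {m} (f : Fin m → ℕ) → L.sum (map f (allFin m)) ≡ sum f
    sum-allFin f = trans (cong L.sum (map-tabulate id f)) (sum-tabulate f)

q+≤1 : ∀ {x} q {y} → x ≡ q + y → y ≤ 1 → x ≡ q ⊎ x ≡ suc q
q+≤1 q {zero}     refl _ = inj₁ (+-identityʳ q)
q+≤1 q {suc zero} refl _ = inj₂ (+-comm q 1)
q+≤1 q {2+ _}     _    (s≤s ())

module TuránParts (n r′ : ℕ) where

  r : ℕ
  r = suc r′

  q : ℕ
  q = n / r

  -- Residues modulo r repeat with period r, so each class meets every full period of {0,…,n−1} once
  -- and the final incomplete period at most once.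
  part-classSize : ∀ a → a < r → classSize (part {n} r) a ≡ q ⊎ classSize (part {n} r) a ≡ suc q
  part-classSize a a<r = q+≤1 q size tail≤1
    where
      h : ℕ → ℕ
      h v = 𝟙 ⌊ a ≟ v % r ⌋
      period : sum {r} (h ∘ toℕ) ≡ 1
      period = trans (sum-cong-≗ {r} (λ i → trans (cong (λ x → 𝟙 ⌊ a ≟ x ⌋) (m<n⇒m%n≡m (toℕ<n i)))
                                     (trans (cong 𝟙 (⌊≟⌋-sym a (toℕ i))) (sym (*-identityʳ _)))))
                     (∑-select (λ _ → 1) a a<r)
      tail≤1 : sum {n % r} (h ∘ toℕ) ≤ 1
      tail≤1 = ≤-trans (∑-toℕ-mono h (<⇒≤ (m%n<n n r))) (≤-reflexive period)
      size : classSize (part {n} r) a ≡ q + sum {n % r} (h ∘ toℕ)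
      size = begin
        sum {n} (h ∘ toℕ)                                                ≡⟨ cong (λ m → sum {m} (h ∘ toℕ)) n≡qr+s ⟩
        sum {q * r + n % r} (h ∘ toℕ)                                    ≡⟨ ∑-toℕ-+ (q * r) (n % r) h ⟩
        sum {q * r} (h ∘ toℕ) + sum {n % r} (λ v → h (q * r + toℕ v))
          ≡⟨ cong₂ _+_ full-periods (sum-cong-≗ {n % r} (shift q ∘ toℕ)) ⟩
        q + sum {n % r} (h ∘ toℕ)                                        ∎
        where
          open ≡-Reasoning
          n≡qr+s : n ≡ q * r + n % r
          n≡qr+s = trans (m≡m%n+[m/n]*n n r) (+-comm (n % r) (q * r))
          shift : ∀ p v → h (p * r + v) ≡ h v
          shift p v = cong (λ x → 𝟙 ⌊ a ≟ x ⌋) (trans (cong (_% r) (+-comm (p * r) v)) ([m+kn]%n≡m%n v p r))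
          full-periods : sum {q * r} (h ∘ toℕ) ≡ q
          full-periods = trans (∑-toℕ-periodic q r h (λ v → trans (cong h (cong (_+ v) (sym (*-identityˡ r)))) (shift 1 v)))
                               (trans (cong (q *_) period) (*-identityʳ q))

turán-cliqueFree : ∀ n r′ → ¬ ContainsK (suc (suc r′)) (turán n (suc r′))
turán-cliqueFree n r′ (f , _ , f-clique) with pigeonhole (n<1+n (suc r′)) (λ i → fromℕ< (m%n<n (toℕ (f i)) (suc r′)))
... | i , j , i<j , same = true≢false (trans (sym (f-clique i j (Fin.<⇒≢ i<j))) different)
  where
    same-part : part (suc r′) (f i) ≡ part (suc r′) (f j)
    same-part = trans (sym (toℕ-fromℕ< _)) (trans (cong toℕ same) (toℕ-fromℕ< _))
    different : adj (turán n (suc r′)) (f i) (f j) ≡ false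
    different = cong not (trans (cong (λ x → ⌊ x ≟ part (suc r′) (f j) ⌋) same-part) (⌊≟⌋-refl _))

eφ-≤-turán : ∀ k r′ {n} → suc k + 2 ≤ suc r′ → suc k * suc r′ ≤ n → (G : Graph n) →
             ¬ ContainsK (suc (suc r′)) G → eφ (suc k) G ≤ eφ (suc k) (turán n (suc r′))
eφ-≤-turán k r′ {n} k+2≤r N≤n G free = begin
  eφ (suc k) G                                                 ≡⟨ eφ-as-sum (suc k) G ⟩
  sum {n} (λ v → degreeIn G all v C suc k)                     ≤⟨ ∑-mono-≤ (λ v → C-monoˡ-≤ (suc k) (dominated v refl)) ⟩
  sum {n} (λ v → crossDegreeIn all c v C suc k)                ≡⟨ eφ-multipartite (suc k) r c (λ v → c<r v refl) ⟩
  sum {r} (λ i → partWeight (suc k) n (classSize c (toℕ i)))   ≤⟨ balanced ⟩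
  sum {r} (λ i → partWeight (suc k) n (classSize cT (toℕ i)))  ≡⟨ eφ-multipartite (suc k) r cT cT<r ⟨
  sum {n} (λ v → crossDegreeIn all cT v C suc k)               ≡⟨ eφ-as-sum (suc k) (turán n r) ⟨
  eφ (suc k) (turán n r)                                       ∎
  where
    open ≤-Reasoning
    open TuránParts n r′
    all : Fin n → Bool
    all _ = true
    majorising = degree-majorisation G r all (λ f f-inj _ f-clique → free (f , f-inj , f-clique))
    c = proj₁ majorising
    c<r = proj₁ (proj₂ majorising)
    dominated = proj₂ (proj₂ majorising)
    cT : Fin n → ℕ
    cT = part r
    cT<r : ∀ v → cT v < r
    cT<r v = m%n<n (toℕ v) r
    balanced : sum {r} (partWeight (suc k) n ∘ classSize c ∘ toℕ) ≤ sum {r} (partWeight (suc k) n ∘ classSize cT ∘ toℕ)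
    balanced = partWeight-balanced-maximises k (quotient-part-small k+2≤r N≤n)
      (classSize c ∘ toℕ) (classSize cT ∘ toℕ) (λ i → classSize≤n c (toℕ i)) (λ i → part-classSize (toℕ i) (toℕ<n i))
      (trans (∑-classSize r c (λ v → c<r v refl)) (sym (∑-classSize r cT cT<r)))

theorem2 : ∀ (k : ℕ) → 1 ≤ k → ∀ (r : ℕ) → k + 2 ≤ r →
    Σ ℕ (λ N → ∀ (n : ℕ) → N ≤ n → IsExφ k n (suc r) (eφ k (turán n r)))
theorem2 (suc k) _ zero    ()
theorem2 (suc k) _ (suc r′) k+2≤r =
  suc k * suc r′ , λ n N≤n → (turán n (suc r′) , turán-cliqueFree n r′ , refl) , eφ-≤-turán k r′ k+2≤r N≤n
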